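{- Let $L_1, L_2$ be disjoint finite lattices with $\operatorname{Dim}(L_1)=m$ and $\operatorname{Dim}(L_2)=n$, let $a<b$ in $L_1$ with $b$ not covering $a$, and let $L = L_1 ]^{b}_{a} L_2$. Then $\operatorname{Dim}(L) \leq \max\{2m, m+n\}$, that is, $\operatorname{Dim}(L) \leq m + \max\{m,n\}$.
   Context: Adjunct sum: for disjoint lattices $L_1,L_2$ and $a<b$ in $L_1$ with $a \not\prec b$, $L = L_1 ]^b_a L_2$ is the set $L_1 \cup L_2$ with $x \leq y$ iff either $x,y\in L_1$ and $x\leq y$ in $L_1$; or $x,y\in L_2$ and $x\leq y$ in $L_2$; or $x\in L_1$, $y\in L_2$ and $x \leq a$ in $L_1$; or $x \in L_2$, $y \in L_1$ and $b \leq y$ in $L_1$. The dimension $\operatorname{Dim}(P)$ of a finite poset $P$ is the least number of linear extensions of its order whose intersection is exactly its order. -}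

module Defs where

open import Data.Nat using (ℕ; _≤_)
open import Data.Fin using (Fin)
open import Data.Sum using (_⊎_; inj₁; inj₂)
open import Data.Product using (Σ; _×_)
open import Data.Empty using (⊥)
open import Relation.Nullary using (¬_)
open import Relation.Binary.Core using (Rel)
open import Relation.Binary.PropositionalEquality using (_≡_)
open import Relation.Binary.Structures using (IsTotalOrder)
open import Relation.Binary.Lattice.Structures using (IsLattice)
open import Algebra.Core using (Op₂)
open import Agda.Primitive using (lzero)

record FinLattice : Set₁ where
  field
    size      : ℕ
    _≤L_      : Rel (Fin size) lzero
    _∨_       : Op₂ (Fin size)
    _∧_       : Op₂ (Fin size)
    isLattice : IsLattice _≡_ _≤L_ _∨_ _∧_

Strict : {A : Set} → Rel A lzero → Rel A lzero
Strict _≤_ x y = (x ≤ y) × ¬ (x ≡ y)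

Covers : {A : Set} → Rel A lzero → A → A → Set
Covers _≤_ a b = Strict _≤_ a b × (∀ z → Strict _≤_ a z → Strict _≤_ z b → ⊥)

record LinExt {A : Set} (_≤_ : Rel A lzero) : Set₁ where
  field
    _⊑_          : Rel A lzero
    isTotalOrder : IsTotalOrder _≡_ _⊑_
    extends      : ∀ {x y} → x ≤ y → x ⊑ y

Realizer : {A : Set} → Rel A lzero → ℕ → Set₁
Realizer {A} _≤_ d =
  Σ (Fin d → LinExt _≤_) λ R → ∀ (x y : A) → (∀ i → LinExt._⊑_ (R i) x y) → x ≤ y

HasDim : {A : Set} → Rel A lzero → ℕ → Set₁
HasDim _≼_ d = Realizer _≼_ d × (∀ d' → Realizer _≼_ d' → d ≤ d')

AdjLe : (L₁ L₂ : FinLattice) → (a b : Fin (FinLattice.size L₁)) →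
        Rel (Fin (FinLattice.size L₁) ⊎ Fin (FinLattice.size L₂)) lzero
AdjLe L₁ L₂ a b (inj₁ x) (inj₁ y) = FinLattice._≤L_ L₁ x y
AdjLe L₁ L₂ a b (inj₂ x) (inj₂ y) = FinLattice._≤L_ L₂ x y
AdjLe L₁ L₂ a b (inj₁ x) (inj₂ y) = FinLattice._≤L_ L₁ x a
AdjLe L₁ L₂ a b (inj₂ x) (inj₁ y) = FinLattice._≤L_ L₁ b y

{-# OPTIONS --safe #-}
module Submission where

open import Defs
open import Data.Nat using (ℕ; _≤_; _+_; _∸_; _⊔_; zero; suc)
open import Data.Nat.Properties using (≤-refl; m≤m⊔n; m≤n⊔m; m∸n+n≡m)
open import Data.Fin as Fin using (Fin; _≟_)
open import Data.Product using (Σ; _×_; _,_; proj₁; proj₂)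
open import Data.Sum using (_⊎_; inj₁; inj₂)
open import Data.Empty using (⊥-elim)
open import Data.Vec.Functional using (_∷_; _++_)
open import Data.Vec.Functional.Relation.Unary.All.Properties using (++⁻)
open import Relation.Nullary using (¬_; yes; no)
open import Relation.Nullary.Decidable using (¬?; decidable-stable)
open import Relation.Unary as U using (Pred)
open import Relation.Binary.Core using (Rel)
open import Relation.Binary.Definitions using (Decidable; DecidableEquality)
open import Relation.Binary.Structures using (IsTotalOrder; IsPartialOrder)
open import Relation.Binary.Lattice.Structures using (IsLattice)
open import Relation.Binary.Consequences using (total∧dec⇒dec)
open import Relation.Binary.PropositionalEquality using (_≡_; refl; cong; subst; isEquivalence)
open import Agda.Primitive using (lzero)

-- Take a realizer R₁ … R_m of L₁ and a realizer S₁ … S_n of L₂,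
-- both padded by repetition to length k = max(m, n). Inserting a linear
-- extension of L₂ directly above a in each R_i gives m linear extensions of L
-- that together force x ≤ a whenever x ∈ L₁ lies below some y ∈ L₂; inserting
-- S_j directly below b in R_j gives k more that force b ≤ y whenever y ∈ L₁
-- lies above some x ∈ L₂, and that realize L₂. These m + k extensions realize L.

module InsertAtCut {A B : Set} {_⊑₁_ : Rel A lzero} {_⊑₂_ : Rel B lzero}
  (total₁ : IsTotalOrder _≡_ _⊑₁_) (total₂ : IsTotalOrder _≡_ _⊑₂_)
  (Low : Pred A lzero) (Low? : U.Decidable Low)
  (Low-downClosed : ∀ {x y} → x ⊑₁ y → Low y → Low x) where

  private
    module T₁ = IsTotalOrder total₁
    module T₂ = IsTotalOrder total₂

  _⊑_ : Rel (A ⊎ B) lzero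
  inj₁ x ⊑ inj₁ y = x ⊑₁ y
  inj₂ x ⊑ inj₂ y = x ⊑₂ y
  inj₁ x ⊑ inj₂ y = Low x
  inj₂ x ⊑ inj₁ y = ¬ Low y

  ⊑-reflexive : ∀ {u v} → u ≡ v → u ⊑ v
  ⊑-reflexive {inj₁ x} refl = T₁.refl
  ⊑-reflexive {inj₂ x} refl = T₂.refl

  ⊑-trans : ∀ {u v w} → u ⊑ v → v ⊑ w → u ⊑ w
  ⊑-trans {inj₁ x} {inj₁ y} {inj₁ z} p q = T₁.trans p q
  ⊑-trans {inj₁ x} {inj₁ y} {inj₂ z} p q = Low-downClosed p q
  ⊑-trans {inj₁ x} {inj₂ y} {inj₁ z} p q with T₁.total x z
  ... | inj₁ x⊑z = x⊑z
  ... | inj₂ z⊑x = ⊥-elim (q (Low-downClosed z⊑x p))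
  ⊑-trans {inj₁ x} {inj₂ y} {inj₂ z} p q = p
  ⊑-trans {inj₂ x} {inj₁ y} {inj₁ z} p q = λ low-z → p (Low-downClosed q low-z)
  ⊑-trans {inj₂ x} {inj₁ y} {inj₂ z} p q = ⊥-elim (p q)
  ⊑-trans {inj₂ x} {inj₂ y} {inj₁ z} p q = q
  ⊑-trans {inj₂ x} {inj₂ y} {inj₂ z} p q = T₂.trans p q

  ⊑-antisym : ∀ {u v} → u ⊑ v → v ⊑ u → u ≡ v
  ⊑-antisym {inj₁ x} {inj₁ y} p q = cong inj₁ (T₁.antisym p q)
  ⊑-antisym {inj₁ x} {inj₂ y} p q = ⊥-elim (q p)
  ⊑-antisym {inj₂ x} {inj₁ y} p q = ⊥-elim (p q)
  ⊑-antisym {inj₂ x} {inj₂ y} p q = cong inj₂ (T₂.antisym p q)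

  ⊑-total : ∀ u v → (u ⊑ v) ⊎ (v ⊑ u)
  ⊑-total (inj₁ x) (inj₁ y) = T₁.total x y
  ⊑-total (inj₂ x) (inj₂ y) = T₂.total x y
  ⊑-total (inj₁ x) (inj₂ y) with Low? x
  ... | yes low = inj₁ low
  ... | no ¬low = inj₂ ¬low
  ⊑-total (inj₂ x) (inj₁ y) with Low? y
  ... | yes low = inj₂ low
  ... | no ¬low = inj₁ ¬low

  isTotalOrder : IsTotalOrder _≡_ _⊑_
  isTotalOrder = record
    { isPartialOrder = record
      { isPreorder = record
        { isEquivalence = isEquivalence
        ; reflexive     = ⊑-reflexive
        ; trans         = λ {u} {v} {w} → ⊑-trans {u} {v} {w}
        }
      ; antisym = λ {u} {v} → ⊑-antisym {u} {v}
      }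
    ; total = ⊑-total
    }

module _ {A : Set} {_≼_ : Rel A lzero} where

  Realizer⇒LinExt : ∀ {n} → IsPartialOrder _≡_ _≼_ → Realizer _≼_ n → LinExt _≼_
  Realizer⇒LinExt {n = suc _} _ (R , _) = R Fin.zero
  Realizer⇒LinExt {n = zero} isPO (_ , realizes) = record
    { _⊑_          = _≼_
    ; isTotalOrder = record { isPartialOrder = isPO ; total = λ x y → inj₁ (realizes x y λ ()) }
    ; extends      = λ x≼y → x≼y
    }

  LinExt-dec : DecidableEquality A → (E : LinExt _≼_) → Decidable (LinExt._⊑_ E)
  LinExt-dec _≟_ E = total∧dec⇒dec reflexive antisym total _≟_
    where open IsTotalOrder (LinExt.isTotalOrder E)

  Realizer-pad : ∀ {n} → LinExt _≼_ → Realizer _≼_ n → ∀ j → Realizer _≼_ (j + n)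
  Realizer-pad E R zero    = R
  Realizer-pad E R (suc j) =
    let (R′ , realizes) = Realizer-pad E R j
    in (E ∷ R′) , λ x y below-all → realizes x y (λ i → below-all (Fin.suc i))

  Realizer-≤ : ∀ {n k} → IsPartialOrder _≡_ _≼_ → Realizer _≼_ n → n ≤ k → Realizer _≼_ k
  Realizer-≤ {n} {k} isPO R n≤k =
    subst (Realizer _≼_) (m∸n+n≡m n≤k) (Realizer-pad (Realizer⇒LinExt isPO R) R (k ∸ n))

module AdjunctSum (L₁ L₂ : FinLattice) {a b : Fin (FinLattice.size L₁)}
  (a<b : Strict (FinLattice._≤L_ L₁) a b) where

  open FinLattice

  _≼_ : Rel (Fin (size L₁) ⊎ Fin (size L₂)) lzero
  _≼_ = AdjLe L₁ L₂ a b

  module _ (R : LinExt (_≤L_ L₁)) (S : LinExt (_≤L_ L₂)) where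
    private
      open module R = LinExt R using () renaming (_⊑_ to _⊑R_)
      module TR = IsTotalOrder R.isTotalOrder
      module Above = InsertAtCut R.isTotalOrder (LinExt.isTotalOrder S)
        (_⊑R a) (λ x → LinExt-dec _≟_ R x a) TR.trans
      module Below = InsertAtCut R.isTotalOrder (LinExt.isTotalOrder S)
        (λ x → ¬ (b ⊑R x)) (λ x → ¬? (LinExt-dec _≟_ R b x))
        (λ x⊑y b⋢y b⊑x → b⋢y (TR.trans b⊑x x⊑y))

      b⋢a : ¬ (b ⊑R a)
      b⋢a b⊑a = proj₂ a<b (TR.antisym (R.extends (proj₁ a<b)) b⊑a)

    insertAbove : LinExt _≼_
    insertAbove = record
      { _⊑_ = Above._⊑_ ; isTotalOrder = Above.isTotalOrder ; extends = λ {u} {v} → extends {u} {v} }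
      where
        extends : ∀ {u v} → u ≼ v → Above._⊑_ u v
        extends {inj₁ x} {inj₁ y} x≤y = R.extends x≤y
        extends {inj₂ x} {inj₂ y} x≤y = LinExt.extends S x≤y
        extends {inj₁ x} {inj₂ y} x≤a = R.extends x≤a
        extends {inj₂ x} {inj₁ y} b≤y = λ y⊑a → b⋢a (TR.trans (R.extends b≤y) y⊑a)

    insertBelow : LinExt _≼_
    insertBelow = record
      { _⊑_ = Below._⊑_ ; isTotalOrder = Below.isTotalOrder ; extends = λ {u} {v} → extends {u} {v} }
      where
        extends : ∀ {u v} → u ≼ v → Below._⊑_ u v
        extends {inj₁ x} {inj₁ y} x≤y = R.extends x≤y
        extends {inj₂ x} {inj₂ y} x≤y = LinExt.extends S x≤y
        extends {inj₁ x} {inj₂ y} x≤a = λ b⊑x → b⋢a (TR.trans b⊑x (R.extends x≤a))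
        extends {inj₂ x} {inj₁ y} b≤y = λ b⋢y → b⋢y (R.extends b≤y)

  Realizer-adjunct : ∀ {m k} → LinExt (_≤L_ L₂) → Realizer (_≤L_ L₁) m →
    Realizer (_≤L_ L₁) k → Realizer (_≤L_ L₂) k → Realizer _≼_ (m + k)
  Realizer-adjunct {m} {k} E (R , R-realizes) (R′ , R′-realizes) (S , S-realizes) =
    above ++ below , realizes
    where
      above : Fin m → LinExt _≼_
      above i = insertAbove (R i) E
      below : Fin k → LinExt _≼_
      below j = insertBelow (R′ j) (S j)

      realizes : ∀ u v → (∀ t → LinExt._⊑_ ((above ++ below) t) u v) → u ≼ v
      realizes u v in-all with ++⁻ (λ F → LinExt._⊑_ F u v) above in-all
      realizes (inj₁ x) (inj₁ y) _ | in-above , _ = R-realizes x y in-above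
      realizes (inj₁ x) (inj₂ y) _ | in-above , _ = R-realizes x a in-above
      realizes (inj₂ x) (inj₂ y) _ | _ , in-below = S-realizes x y in-below
      realizes (inj₂ x) (inj₁ y) _ | _ , in-below = R′-realizes b y λ j →
        decidable-stable (LinExt-dec _≟_ (R′ j) b y) (in-below j)

-- The non-covering hypothesis only ensures that L is a lattice; the bound does not need it.
mainTheorem6 : (L₁ L₂ : FinLattice) (m n : ℕ) →
    HasDim (FinLattice._≤L_ L₁) m → HasDim (FinLattice._≤L_ L₂) n →
    (a b : Fin (FinLattice.size L₁)) →
    Strict (FinLattice._≤L_ L₁) a b → ¬ Covers (FinLattice._≤L_ L₁) a b →
    Σ ℕ λ d → (d ≤ m + (m ⊔ n)) × Realizer (AdjLe L₁ L₂ a b) d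
mainTheorem6 L₁ L₂ m n (R , _) (S , _) a b a<b _ =
  m + (m ⊔ n) , ≤-refl ,
  Realizer-adjunct (Realizer⇒LinExt isPO₂ S) R
    (Realizer-≤ isPO₁ R (m≤m⊔n m n)) (Realizer-≤ isPO₂ S (m≤n⊔m m n))
  where
    open AdjunctSum L₁ L₂ a<b
    isPO₁ : IsPartialOrder _≡_ (FinLattice._≤L_ L₁)
    isPO₁ = IsLattice.isPartialOrder (FinLattice.isLattice L₁)
    isPO₂ : IsPartialOrder _≡_ (FinLattice._≤L_ L₂)
    isPO₂ = IsLattice.isPartialOrder (FinLattice.isLattice L₂)
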